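{- Let $r,n$ be positive integers, $W=C_r\wr S_n$, and let $t$ be an integer with $0\le t\le n-1$. Suppose $Y\subseteq W$ is a $t$-design and an $(n-t)$-code. Then the distance distribution $(A_i)$ of $Y$ satisfies $$A_{n-i}=\sum_{j=i}^t(-1)^{j-i}\binom ji\binom nj\Big(\frac{|Y|}{r^j(n)_j}-1\Big)$$ for each $i\in\{0,1,\dots,n-1\}$.
   Context: $C_r=\mathbb{Z}/r\mathbb{Z}$; $[n]=\{1,\dots,n\}$. $W=C_r\wr S_n$ consists of pairs $(g,\pi)$, $g\in C_r^n$, $\pi\in S_n$, with $(f,\pi)(g,\sigma)=(f+g^\pi,\pi\sigma)$, $g^\pi=(g_{\pi^{ -1}(1)},\dots,g_{\pi^{ -1}(n)})$, acting on $C_r\times[n]$ by $(g,\pi)\cdot(c,i)=(c+g_{\pi(i)},\pi(i))$. $(n)_j=n(n-1)\cdots(n-j+1)$. A nonempty $Y\subseteq W$ is a $t$-design if there is $c>0$ such that for any two $t$-tuples $((c_1,i_1),\dots,(c_t,i_t))$, $((c'_1,i'_1),\dots,(c'_t,i'_t))$ of elements of $C_r\times[n]$ with $i_1,\dots,i_t$ pairwise distinct and $i'_1,\dots,i'_t$ pairwise distinct, exactly $c$ elements of $Y$ map the first tuple to the second (componentwise). For $1\le d\le n+1$, $Y$ is a $d$-code if for all distinct $x,y\in Y$ the element $x^{ -1}y$ fixes $(0,i)$ for at most $n-d$ indices $i\in[n]$ (equivalently, $x^{ -1}y$ fixes no tuple of $n-d+1$ elements $(c_k,i_k)$ with pairwise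 distinct $i_k$). For $g\in W$, $\theta(g)=\frac1r|\{(c,i):g(c,i)=(c,i)\}|$, and $d(x,y)=n-\theta(x^{ -1}y)$. The distance distribution of $Y$ is $A_i=\frac1{|Y|}|\{(x,y)\in Y\times Y:d(x,y)=i\}|$, $0\le i\le n$. -}

module Defs where

open import Data.Nat using (ℕ; zero; suc; _+_; _*_; _∸_; _^_; _≤_; _<_; NonZero)
open import Data.Nat.DivMod using (_mod_; _/_)
open import Data.Nat.Combinatorics using (_C_; _P_)
open import Data.Fin using (Fin; toℕ) renaming (zero to fzero)
import Data.Fin.Properties as FinP
open import Data.Vec using (Vec; lookup; map)
import Data.Vec.Properties as VecP
open import Data.List using (List; length; filter; applyUpTo; foldr; allFin; cartesianProduct)
open import Data.Product using (_×_; _,_; proj₁; proj₂; Σ)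
import Data.Product.Properties as ProdP
open import Data.Integer using (ℤ; +_)
open import Data.Rational using (ℚ; 0ℚ; 1ℚ; -_) renaming (_/_ to _/ℚ_; _+_ to _+ℚ_; _*_ to _*ℚ_; _-_ to _-ℚ_)
open import Relation.Binary.PropositionalEquality using (_≡_; _≢_)
open import Relation.Binary using (DecidableEquality)
open import Relation.Nullary using (Dec)
open import Function.Definitions using (Injective)

_+C_ : {r : ℕ} → Fin r → Fin r → Fin r
_+C_ {suc k} a b = (toℕ a + toℕ b) mod (suc k)

zeroC : (r : ℕ) → .{{_ : NonZero r}} → Fin r
zeroC (suc k) = fzero

-- An element (g, π) of C_r ≀ S_n: g ∈ C_r^n and π given by its list of
-- values (π(1),…,π(n)); it is a genuine element of W when π is injective.
W : ℕ → ℕ → Set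
W r n = Vec (Fin r) n × Vec (Fin n) n

IsPerm : {n : ℕ} → Vec (Fin n) n → Set
IsPerm π = Injective _≡_ _≡_ (lookup π)

IsElem : {r n : ℕ} → W r n → Set
IsElem (g , π) = IsPerm π

act : {r n : ℕ} → W r n → Fin r × Fin n → Fin r × Fin n
act (g , π) (c , i) = (c +C lookup g (lookup π i) , lookup π i)

_≟W_ : {r n : ℕ} → DecidableEquality (W r n)
_≟W_ = ProdP.≡-dec (VecP.≡-dec FinP._≟_) (VecP.≡-dec FinP._≟_)

_≟P_ : {r n : ℕ} → DecidableEquality (Fin r × Fin n)
_≟P_ = ProdP.≡-dec FinP._≟_ FinP._≟_

_≟T_ : {r n t : ℕ} → DecidableEquality (Vec (Fin r × Fin n) t)
_≟T_ = VecP.≡-dec _≟P_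

countL : {A : Set} {P : A → Set} → ((a : A) → Dec (P a)) → List A → ℕ
countL P? xs = length (filter P? xs)

DistinctIdx : {r n t : ℕ} → Vec (Fin r × Fin n) t → Set
DistinctIdx v = Injective _≡_ _≡_ (λ k → proj₂ (lookup v k))

-- Y (a finite subset of W, listed without repetition) is a t-design
IsDesign : {r n : ℕ} → (t : ℕ) → List (W r n) → Set
IsDesign {r} {n} t Y =
  Σ ℕ λ c → (0 < c) ×
    ((u v : Vec (Fin r × Fin n) t) → DistinctIdx u → DistinctIdx v →
      countL (λ x → map (act x) u ≟T v) Y ≡ c)

-- x⁻¹y fixes p  iff  x·p = y·p  (x is a bijection).
-- Number of i ∈ [n] with x⁻¹y fixing (0,i):
fix0 : {r n : ℕ} → .{{_ : NonZero r}} → W r n → W r n → ℕ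
fix0 {r} {n} x y = countL (λ i → act x (zeroC r , i) ≟P act y (zeroC r , i)) (allFin n)

IsCode : {r n : ℕ} → .{{_ : NonZero r}} → (d : ℕ) → List (W r n) → Set
IsCode {r} {n} d Y = ∀ {x y} → x Data.List.Membership.Propositional.∈ Y → y Data.List.Membership.Propositional.∈ Y → x ≢ y → fix0 x y ≤ n ∸ d
  where import Data.List.Membership.Propositional

-- θ(x⁻¹y) = (1/r) · #{(c,i) : x⁻¹y (c,i) = (c,i)}
θ : {r n : ℕ} → .{{_ : NonZero r}} → W r n → W r n → ℕ
θ {r} {n} x y = countL (λ p → act x p ≟P act y p) (cartesianProduct (allFin r) (allFin n)) / r

dist : {r n : ℕ} → .{{_ : NonZero r}} → W r n → W r n → ℕ
dist {r} {n} x y = n ∸ θ x y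

-- p / q as a rational (q = 0 gives 0; only used with q ≠ 0)
_÷ℕ_ : ℕ → ℕ → ℚ
p ÷ℕ zero = 0ℚ
p ÷ℕ suc q = (+ p) /ℚ (suc q)

ℕtoℚ : ℕ → ℚ
ℕtoℚ p = (+ p) /ℚ 1

A : {r n : ℕ} → .{{_ : NonZero r}} → List (W r n) → ℕ → ℚ
A Y i = countL (λ xy → dist (proj₁ xy) (proj₂ xy) Data.Nat.≟ i) (cartesianProduct Y Y) ÷ℕ length Y
  where import Data.Nat

sign : ℕ → ℚ
sign zero = 1ℚ
sign (suc k) = - sign k

sumℚ : List ℚ → ℚ
sumℚ = foldr _+ℚ_ 0ℚ

Σ[_⋯_] : ℕ → ℕ → (ℕ → ℚ) → ℚ
Σ[ a ⋯ b ] f = sumℚ (applyUpTo (λ k → f (a + k)) (suc b ∸ a))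

rhs : (r n t : ℕ) → ℕ → ℕ → ℚ
rhs r n t sizeY i = Σ[ i ⋯ t ] (λ j →
  sign (j ∸ i) *ℚ ℕtoℚ ((j C i) * (n C j)) *ℚ
    ((sizeY ÷ℕ (r ^ j * (n P j))) -ℚ 1ℚ))

{-# OPTIONS --safe #-}
module Submission where

-- Let f(x, y) = fix0 x y, the number of i with x(0, i) = y(0, i). Agreement of x and y at (c, i)
-- does not depend on the colour c, so θ(x⁻¹y) = f(x, y) and d(x, y) = n − f(x, y). Summing over the
-- image of one extra point shows that a t-design is a j-design for every j ≤ t, with constant
-- κ_j = |Y| / (r^j (n)_j). Counting the ordered j-tuples of indices at which y agrees with a
-- fixed x ∈ Y gives the factorial moments Σ_{y ∈ Y} (f(x, y))_j = (n)_j κ_j, hence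
-- Σ_{y ≠ x} C(f(x, y), j) = C(n, j) (κ_j − 1) for j ≤ t. As Y is an (n − t)-code, f(x, y) ≤ t
-- for y ≠ x, and binomial inversion [f = i] = Σ_{j=i}^{t} (−1)^{j−i} C(j, i) C(f, j) turns these
-- moments into the number of y at distance n − i from x, which is therefore the same for all x.

open import Defs
open import Data.Nat using (ℕ; _<_; _∸_; NonZero)
open import Data.List using (List; length)
open import Data.List.Relation.Unary.All using (All)
open import Data.List.Relation.Unary.Unique.Propositional using (Unique)
open import Relation.Binary.PropositionalEquality using (_≡_)

open import Algebra.Bundles using (CommutativeSemiring; CommutativeRing)
import Algebra.Properties.CommutativeSemigroup as CommSemigroupProperties
open import Data.Bool using (true)
open import Data.Empty using (⊥-elim)
open import Data.Fin using (Fin; toℕ) renaming (zero to fzero; suc to fsuc)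
import Data.Fin.Properties as FP
import Data.Integer as ℤ
import Data.Integer.Properties as ZP
open import Data.List as List using ([]; _∷_; _++_; foldr; cartesianProduct; allFin; upTo; applyUpTo)
open import Data.List.Membership.Propositional using (_∈_)
import Data.List.Membership.Propositional.Properties as DMP
import Data.List.Properties as DLP
import Data.List.Relation.Unary.All as All
open import Data.List.Relation.Unary.AllPairs using (_∷_)
open import Data.List.Relation.Unary.Any using (here; there)
import Data.List.Relation.Unary.Unique.Propositional.Properties as UP
open import Data.Nat.Combinatorics using (_C_; _P_)
import Data.Nat.Combinatorics as Comb
import Data.Nat.Combinatorics.Base as CB
import Data.Nat.Coprimality as Cop
import Data.Nat.DivMod as DM
open DM using (_%_; _/_)
import Data.Nat.Properties as NP
open import Data.Nat.Tactic.RingSolver using (solve-∀)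
open import Data.Product using (_×_; _,_; proj₁; proj₂; ∃)
open import Data.Rational as ℚ using (ℚ; mkℚ; 0ℚ; 1ℚ; -_)
  renaming (_+_ to _+ℚ_; _*_ to _*ℚ_; _-_ to _-ℚ_; _/_ to _/ℚ_)
import Data.Rational.Properties as QP
import Data.Rational.Solver
import Data.Rational.Unnormalised as ℚᵘ
open import Data.Sum using (_⊎_; inj₁; inj₂)
open import Data.Vec as V using (Vec; []; _∷_)
import Data.Vec.Properties as VP
import Data.Vec.Relation.Unary.All as VAll
open VAll using ([]; _∷_)
import Data.Vec.Relation.Unary.All.Properties as VAllP
import Data.Vec.Relation.Unary.AllPairs as VAllPairs
open VAllPairs using ([]; _∷_)
import Data.Vec.Relation.Unary.AllPairs.Properties as VAllPairsP
open import Function using (_∘_; id)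
open import Relation.Binary.Definitions using (DecidableEquality)
import Relation.Binary.PropositionalEquality as ≡
open ≡ using (_≢_)
open import Relation.Nullary using (Dec; yes; no; ¬_; ¬?)
open import Relation.Unary using (Decidable)

-- Sums over lists in a commutative semiring

module ListSum {c ℓ} (R : CommutativeSemiring c ℓ) where
  open CommutativeSemiring R
  open CommSemigroupProperties +-commutativeSemigroup using (interchange; x∙yz≈y∙xz)
  open import Relation.Binary.Reasoning.Setoid setoid

  private variable I J : Set

  ∑ : List I → (I → Carrier) → Carrier
  ∑ xs f = foldr _+_ 0# (List.map f xs)

  𝟙 : {P : Set} → Dec P → Carrier
  𝟙 (yes _) = 1#
  𝟙 (no _) = 0#

  ∑-cong-∈ : ∀ (xs : List I) {f g : I → Carrier} → (∀ {a} → a ∈ xs → f a ≈ g a) → ∑ xs f ≈ ∑ xs g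
  ∑-cong-∈ [] f≈g = refl
  ∑-cong-∈ (x ∷ xs) f≈g = +-cong (f≈g (here ≡.refl)) (∑-cong-∈ xs (f≈g ∘ there))

  ∑-cong : ∀ (xs : List I) {f g : I → Carrier} → (∀ a → f a ≈ g a) → ∑ xs f ≈ ∑ xs g
  ∑-cong xs f≈g = ∑-cong-∈ xs (λ {a} _ → f≈g a)

  ∑-zero : ∀ (xs : List I) → ∑ xs (λ _ → 0#) ≈ 0#
  ∑-zero [] = refl
  ∑-zero (x ∷ xs) = trans (+-identityˡ _) (∑-zero xs)

  ∑-+ : ∀ (xs : List I) (f g : I → Carrier) → ∑ xs (λ a → f a + g a) ≈ ∑ xs f + ∑ xs g
  ∑-+ [] f g = sym (+-identityˡ 0#)
  ∑-+ (x ∷ xs) f g = trans (+-congˡ (∑-+ xs f g)) (interchange (f x) (g x) (∑ xs f) (∑ xs g))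

  *-distribˡ-∑ : ∀ (xs : List I) a (f : I → Carrier) → a * ∑ xs f ≈ ∑ xs (λ x → a * f x)
  *-distribˡ-∑ [] a f = zeroʳ a
  *-distribˡ-∑ (x ∷ xs) a f = trans (distribˡ a (f x) (∑ xs f)) (+-congˡ (*-distribˡ-∑ xs a f))

  *-distribʳ-∑ : ∀ (xs : List I) a (f : I → Carrier) → ∑ xs f * a ≈ ∑ xs (λ x → f x * a)
  *-distribʳ-∑ [] a f = zeroˡ a
  *-distribʳ-∑ (x ∷ xs) a f = trans (distribʳ a (f x) (∑ xs f)) (+-congˡ (*-distribʳ-∑ xs a f))

  ∑-++ : ∀ (xs ys : List I) (f : I → Carrier) → ∑ (xs ++ ys) f ≈ ∑ xs f + ∑ ys f
  ∑-++ [] ys f = sym (+-identityˡ _)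
  ∑-++ (x ∷ xs) ys f = trans (+-congˡ (∑-++ xs ys f)) (sym (+-assoc (f x) _ _))

  ∑-swap : ∀ (xs : List I) (ys : List J) (f : I → J → Carrier) →
           ∑ xs (λ a → ∑ ys (f a)) ≈ ∑ ys (λ b → ∑ xs (λ a → f a b))
  ∑-swap [] ys f = sym (∑-zero ys)
  ∑-swap (x ∷ xs) ys f = trans (+-congˡ (∑-swap xs ys f)) (sym (∑-+ ys (f x) (λ b → ∑ xs (λ a → f a b))))

  ∑-cartesianProduct : ∀ (xs : List I) (ys : List J) (f : I × J → Carrier) →
                       ∑ (cartesianProduct xs ys) f ≈ ∑ xs (λ a → ∑ ys (λ b → f (a , b)))
  ∑-cartesianProduct [] ys f = refl
  ∑-cartesianProduct (x ∷ xs) ys f = begin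
    ∑ (List.map (x ,_) ys ++ cartesianProduct xs ys) f
      ≈⟨ ∑-++ (List.map (x ,_) ys) _ f ⟩
    ∑ (List.map (x ,_) ys) f + ∑ (cartesianProduct xs ys) f
      ≡⟨ ≡.cong (_+ _) (≡.cong (foldr _+_ 0#) (≡.sym (DLP.map-∘ ys))) ⟩
    ∑ ys (λ b → f (x , b)) + ∑ (cartesianProduct xs ys) f
      ≈⟨ +-congˡ (∑-cartesianProduct xs ys f) ⟩
    ∑ ys (λ b → f (x , b)) + ∑ xs (λ a → ∑ ys (λ b → f (a , b))) ∎

  𝟙-yes : {P : Set} → P → (d : Dec P) → 𝟙 d ≡ 1#
  𝟙-yes p (yes _) = ≡.refl
  𝟙-yes p (no ¬p) = ⊥-elim (¬p p)

  𝟙-no : {P : Set} → ¬ P → (d : Dec P) → 𝟙 d ≡ 0#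
  𝟙-no ¬p (yes p) = ⊥-elim (¬p p)
  𝟙-no ¬p (no _) = ≡.refl

  𝟙-⇔ : {P Q : Set} → (P → Q) → (Q → P) → (d : Dec P) (e : Dec Q) → 𝟙 d ≡ 𝟙 e
  𝟙-⇔ P→Q Q→P (yes p) e = ≡.sym (𝟙-yes (P→Q p) e)
  𝟙-⇔ P→Q Q→P (no ¬p) e = ≡.sym (𝟙-no (¬p ∘ Q→P) e)

  module _ (_≟_ : DecidableEquality I) where

    ∑-𝟙≟-absent : ∀ {xs b} → All (b ≢_) xs → (f : I → Carrier) →
                  ∑ xs (λ a → 𝟙 (a ≟ b) * f a) ≈ 0#
    ∑-𝟙≟-absent {xs} {b} b∉xs f = trans (∑-cong-∈ xs vanish) (∑-zero xs)
      where
      vanish : ∀ {a} → a ∈ xs → 𝟙 (a ≟ b) * f a ≈ 0#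
      vanish {a} a∈xs with a ≟ b
      ... | yes ≡.refl = ⊥-elim (All.lookup b∉xs a∈xs ≡.refl)
      ... | no _ = zeroˡ (f a)

    ∑-pick : ∀ {xs : List I} → Unique xs → ∀ {b} → b ∈ xs → (f : I → Carrier) →
             ∑ xs (λ a → 𝟙 (a ≟ b) * f a) ≈ f b
    ∑-pick {x ∷ _} (x∉xs ∷ _) (here ≡.refl) f with x ≟ x
    ... | yes _ = trans (+-cong (*-identityˡ (f x)) (∑-𝟙≟-absent x∉xs f)) (+-identityʳ (f x))
    ... | no x≢x = ⊥-elim (x≢x ≡.refl)
    ∑-pick {x ∷ _} (x∉xs ∷ unique) {b} (there b∈xs) f with x ≟ b
    ... | yes x≡b = ⊥-elim (All.lookup x∉xs b∈xs x≡b)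
    ... | no _ = trans (+-cong (zeroˡ (f x)) (∑-pick unique b∈xs f)) (+-identityˡ (f b))

    ∑-remove : ∀ {xs : List I} → Unique xs → ∀ {b} → b ∈ xs → (f : I → Carrier) →
               ∑ xs f ≈ f b + ∑ (List.filter (λ a → ¬? (a ≟ b)) xs) f
    ∑-remove {x ∷ xs} (x∉xs ∷ _) (here ≡.refl) f = +-congˡ (reflexive (≡.cong (λ l → ∑ l f) (≡.sym others≡xs)))
      where
      others≡xs : List.filter (λ a → ¬? (a ≟ x)) (x ∷ xs) ≡ xs
      others≡xs = ≡.trans (DLP.filter-reject (λ a → ¬? (a ≟ x)) (λ x≢x → x≢x ≡.refl))
                          (DLP.filter-all (λ a → ¬? (a ≟ x)) (All.map (λ x≢a a≡x → x≢a (≡.sym a≡x)) x∉xs))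
    ∑-remove {x ∷ xs} (x∉xs ∷ unique) {b} (there b∈xs) f = begin
      f x + ∑ xs f                                           ≈⟨ +-congˡ (∑-remove unique b∈xs f) ⟩
      f x + (f b + ∑ (List.filter (λ a → ¬? (a ≟ b)) xs) f)  ≈⟨ x∙yz≈y∙xz (f x) (f b) _ ⟩
      f b + ∑ (x ∷ List.filter (λ a → ¬? (a ≟ b)) xs) f      ≡⟨ ≡.cong (λ l → f b + ∑ l f) (≡.sym x-kept) ⟩
      f b + ∑ (List.filter (λ a → ¬? (a ≟ b)) (x ∷ xs)) f    ∎
      where
      x-kept = DLP.filter-accept (λ a → ¬? (a ≟ b)) (All.lookup x∉xs b∈xs)

open import Data.Nat
  using (zero; suc; pred; _+_; _*_; _^_; _≤_; _≤ᵇ_; _≟_; z≤n; s≤s; _!; >-nonZero; ≢-nonZero⁻¹)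
open import Relation.Binary.PropositionalEquality using (refl; sym; trans; cong; cong₂; subst; module ≡-Reasoning)

open ListSum NP.+-*-commutativeSemiring
open CommSemigroupProperties NP.*-commutativeSemigroup
  using (xy∙z≈y∙xz; xy∙z≈xz∙y) renaming (interchange to *-interchange)

private variable I : Set

∑-const : ∀ (xs : List I) c → ∑ xs (λ _ → c) ≡ length xs * c
∑-const [] c = refl
∑-const (x ∷ xs) c = cong (c +_) (∑-const xs c)

countL≡∑𝟙 : {P : I → Set} (P? : Decidable P) (xs : List I) → countL P? xs ≡ ∑ xs (𝟙 ∘ P?)
countL≡∑𝟙 P? [] = refl
countL≡∑𝟙 P? (x ∷ xs) with P? x
... | yes _ = cong suc (countL≡∑𝟙 P? xs)
... | no _ = countL≡∑𝟙 P? xs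

∑𝟙-witness : {P : I → Set} (P? : Decidable P) (xs : List I) → 0 < ∑ xs (𝟙 ∘ P?) → ∃ P
∑𝟙-witness P? (x ∷ xs) positive with P? x
... | yes px = x , px
... | no _ = ∑𝟙-witness P? xs positive

nonZero-length⇒∈ : {xs : List I} → NonZero (length xs) → ∃ (_∈ xs)
nonZero-length⇒∈ {xs = []} nonZero = ⊥-elim (≢-nonZero⁻¹ 0 {{nonZero}} refl)
nonZero-length⇒∈ {xs = x ∷ _} _ = x , here refl

length-allFin : ∀ n → length (allFin n) ≡ n
length-allFin n = DLP.length-tabulate id

-- Falling factorials and binomial coefficients

infixl 8 _↓_

_↓_ : ℕ → ℕ → ℕ
a ↓ zero = 1
a ↓ suc k = a * (pred a ↓ k)

↓-+ : ∀ a i k → a ↓ (i + k) ≡ a ↓ i * (a ∸ i) ↓ k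
↓-+ a zero k = sym (NP.+-identityʳ (a ↓ k))
↓-+ a (suc i) k = begin
  a * (pred a ↓ (i + k))                ≡⟨ cong (a *_) (↓-+ (pred a) i k) ⟩
  a * (pred a ↓ i * (pred a ∸ i) ↓ k)   ≡⟨ sym (NP.*-assoc a _ _) ⟩
  a * pred a ↓ i * (pred a ∸ i) ↓ k     ≡⟨ cong (λ b → a * pred a ↓ i * b ↓ k) (pred[a]∸i≡a∸suc[i] a) ⟩
  a * pred a ↓ i * (a ∸ suc i) ↓ k      ∎
  where
  open ≡-Reasoning
  pred[a]∸i≡a∸suc[i] : ∀ a → pred a ∸ i ≡ a ∸ suc i
  pred[a]∸i≡a∸suc[i] zero = NP.0∸n≡0 i
  pred[a]∸i≡a∸suc[i] (suc a) = refl

↓-nonZero : ∀ {a k} → k ≤ a → NonZero (a ↓ k)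
↓-nonZero {k = zero} _ = _
↓-nonZero {suc a} {suc k} (s≤s k≤a) = NP.m*n≢0 (suc a) (a ↓ k) {{_}} {{↓-nonZero k≤a}}

↓-zero : ∀ a k → a < k → a ↓ k ≡ 0
↓-zero zero (suc k) _ = refl
↓-zero (suc a) (suc k) (s≤s a<k) = trans (cong (suc a *_) (↓-zero a k a<k)) (NP.*-zeroʳ (suc a))

n↓n≡n! : ∀ n → n ↓ n ≡ n !
n↓n≡n! zero = refl
n↓n≡n! (suc n) = cong (suc n *_) (n↓n≡n! n)

nCk*[k!*[n∸k]!]≡n! : ∀ {n k} → k ≤ n → (n C k) * (k ! * (n ∸ k) !) ≡ n !
nCk*[k!*[n∸k]!]≡n! {n} {k} k≤n = trans (cong (_* (k ! * (n ∸ k) !)) (Comb.nCk≡n!/k![n-k]! k≤n))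
                                       (DM.m/n*n≡m (Comb.k![n∸k]!∣n! k≤n))
  where instance _ = k NP.!* (n ∸ k) !≢0

a↓k≡aCk*k! : ∀ a k → a ↓ k ≡ (a C k) * k !
a↓k≡aCk*k! a k with NP.≤-<-connex k a
... | inj₂ a<k = trans (↓-zero a k a<k) (sym (cong (_* k !) (Comb.k>n⇒nCk≡0 a<k)))
... | inj₁ k≤a = NP.*-cancelʳ-≡ (a ↓ k) ((a C k) * k !) ((a ∸ k) !) {{(a ∸ k) NP.!≢0}} (begin
  a ↓ k * (a ∸ k) !               ≡⟨ cong (a ↓ k *_) (sym (n↓n≡n! (a ∸ k))) ⟩
  a ↓ k * (a ∸ k) ↓ (a ∸ k)       ≡⟨ sym (↓-+ a k (a ∸ k)) ⟩
  a ↓ (k + (a ∸ k))               ≡⟨ cong (a ↓_) (NP.m+[n∸m]≡n k≤a) ⟩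
  a ↓ a                           ≡⟨ n↓n≡n! a ⟩
  a !                             ≡⟨ sym (nCk*[k!*[n∸k]!]≡n! k≤a) ⟩
  (a C k) * (k ! * (a ∸ k) !)     ≡⟨ sym (NP.*-assoc (a C k) (k !) _) ⟩
  (a C k) * k ! * (a ∸ k) !       ∎)
  where open ≡-Reasoning

↓-suc : ∀ a k → a ↓ suc k ≡ a ↓ k * (a ∸ k)
↓-suc a k = begin
  a ↓ suc k               ≡⟨ cong (a ↓_) (NP.+-comm 1 k) ⟩
  a ↓ (k + 1)             ≡⟨ ↓-+ a k 1 ⟩
  a ↓ k * (a ∸ k) ↓ 1     ≡⟨ cong (a ↓ k *_) (NP.*-identityʳ (a ∸ k)) ⟩
  a ↓ k * (a ∸ k)         ∎
  where open ≡-Reasoning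

nPk≡n↓k : ∀ {n k} → k ≤ n → n P k ≡ n ↓ k
nPk≡n↓k {n} {k} k≤n with k ≤ᵇ n | NP.≤⇒≤ᵇ k≤n
... | true | _ = nP′k≡n↓k k
  where
  nP′k≡n↓k : ∀ k → n CB.P′ k ≡ n ↓ k
  nP′k≡n↓k zero = refl
  nP′k≡n↓k (suc k) =
    trans (cong ((n ∸ k) *_) (nP′k≡n↓k k)) (trans (NP.*-comm (n ∸ k) (n ↓ k)) (sym (↓-suc n k)))

[i+k]Ci*fC[i+k]≡fCi*[f∸i]Ck : ∀ f i k → ((i + k) C i) * (f C (i + k)) ≡ (f C i) * ((f ∸ i) C k)
-- Multiplied by i! k!, both sides become f ↓ (i + k).
[i+k]Ci*fC[i+k]≡fCi*[f∸i]Ck f i k = NP.*-cancelʳ-≡ _ _ (i ! * k !) {{i NP.!* k !≢0}} (begin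
  ((i + k) C i) * (f C (i + k)) * (i ! * k !)
    ≡⟨ xy∙z≈y∙xz ((i + k) C i) (f C (i + k)) (i ! * k !) ⟩
  (f C (i + k)) * (((i + k) C i) * (i ! * k !))
    ≡⟨ cong (λ m → (f C (i + k)) * (((i + k) C i) * (i ! * m !))) (sym (NP.m+n∸m≡n i k)) ⟩
  (f C (i + k)) * (((i + k) C i) * (i ! * (i + k ∸ i) !))
    ≡⟨ cong ((f C (i + k)) *_) (nCk*[k!*[n∸k]!]≡n! (NP.m≤m+n i k)) ⟩
  (f C (i + k)) * (i + k) !
    ≡⟨ sym (a↓k≡aCk*k! f (i + k)) ⟩
  f ↓ (i + k)
    ≡⟨ ↓-+ f i k ⟩
  f ↓ i * (f ∸ i) ↓ k
    ≡⟨ cong₂ _*_ (a↓k≡aCk*k! f i) (a↓k≡aCk*k! (f ∸ i) k) ⟩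
  (f C i) * i ! * (((f ∸ i) C k) * k !)
    ≡⟨ *-interchange (f C i) (i !) ((f ∸ i) C k) (k !) ⟩
  (f C i) * ((f ∸ i) C k) * (i ! * k !) ∎)
  where open ≡-Reasoning

fCi*𝟙[f∸i≟0]≡𝟙[f≟i] : ∀ {f i} → i ≤ f → (f C i) * 𝟙 (f ∸ i ≟ 0) ≡ 𝟙 (f ≟ i)
fCi*𝟙[f∸i≟0]≡𝟙[f≟i] {f} {i} i≤f with f ≟ i
... | yes refl = cong₂ _*_ (Comb.nCn≡1 f) (𝟙-yes (NP.n∸n≡0 f) (f ∸ f ≟ 0))
... | no f≢i = trans (cong ((f C i) *_) (𝟙-no f∸i≢0 (f ∸ i ≟ 0))) (NP.*-zeroʳ (f C i))
  where
  f∸i≢0 : f ∸ i ≢ 0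
  f∸i≢0 f∸i≡0 = f≢i (NP.≤-antisym (NP.m∸n≡0⇒m≤n f∸i≡0) i≤f)

i+k≤t : ∀ {i k t} → k < suc t ∸ i → i + k ≤ t
i+k≤t {i} {k} {t} k<1+t∸i =
  NP.≤-pred (subst (_≤ suc t) (cong suc (NP.+-comm k i)) (NP.m≤o∸n⇒m+n≤o (suc k) i≤1+t k<1+t∸i))
  where
  i≤1+t : i ≤ suc t
  i≤1+t = NP.<⇒≤ (NP.m∸n≢0⇒n<m (λ 1+t∸i≡0 → NP.n≮0 (subst (k <_) 1+t∸i≡0 k<1+t∸i)))

-- Rational arithmetic and binomial inversion

module ℚ∑ = ListSum (CommutativeRing.commutativeSemiring QP.+-*-commutativeRing)
module ℚ* = CommSemigroupProperties (CommutativeRing.*-commutativeSemigroup QP.+-*-commutativeRing)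
module QS = Data.Rational.Solver.+-*-Solver

ℕtoℚ≡mkℚ : ∀ a → ℕtoℚ a ≡ mkℚ (ℤ.+ a) 0 (Cop.sym (Cop.1-coprimeTo a))
ℕtoℚ≡mkℚ a = QP.↥p/↧p≡p (mkℚ (ℤ.+ a) 0 (Cop.sym (Cop.1-coprimeTo a)))

ℕtoℚ-+ : ∀ a b → ℕtoℚ (a + b) ≡ ℕtoℚ a +ℚ ℕtoℚ b
ℕtoℚ-+ a b = sym (trans (cong₂ _+ℚ_ (ℕtoℚ≡mkℚ a) (ℕtoℚ≡mkℚ b)) (cong (_/ℚ 1) numerators))
  where
  numerators : ℤ.+ a ℤ.* ℤ.+ 1 ℤ.+ ℤ.+ b ℤ.* ℤ.+ 1 ≡ ℤ.+ (a + b)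
  numerators = trans (cong₂ ℤ._+_ (ZP.*-identityʳ (ℤ.+ a)) (ZP.*-identityʳ (ℤ.+ b))) (sym (ZP.pos-+ a b))

ℕtoℚ-* : ∀ a b → ℕtoℚ (a * b) ≡ ℕtoℚ a *ℚ ℕtoℚ b
ℕtoℚ-* a b = sym (trans (cong₂ _*ℚ_ (ℕtoℚ≡mkℚ a) (ℕtoℚ≡mkℚ b)) (cong (_/ℚ 1) (sym (ZP.pos-* a b))))

ℕtoℚ-injective : ∀ {a b} → ℕtoℚ a ≡ ℕtoℚ b → a ≡ b
ℕtoℚ-injective {a} {b} eq =
  ZP.+-injective (cong ℚ.↥_ (trans (sym (ℕtoℚ≡mkℚ a)) (trans eq (ℕtoℚ≡mkℚ b))))

ℕtoℚ-∑ : ∀ (xs : List I) (f : I → ℕ) → ℕtoℚ (∑ xs f) ≡ ℚ∑.∑ xs (ℕtoℚ ∘ f)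
ℕtoℚ-∑ [] f = refl
ℕtoℚ-∑ (x ∷ xs) f = trans (ℕtoℚ-+ (f x) (∑ xs f)) (cong (ℕtoℚ (f x) +ℚ_) (ℕtoℚ-∑ xs f))

[q*a]÷ℕq≡a : ∀ q a → .{{NonZero q}} → (q * a) ÷ℕ q ≡ ℕtoℚ a
[q*a]÷ℕq≡a (suc q) a = QP.fromℚᵘ-cong {ℚᵘ.mkℚᵘ (ℤ.+ (suc q * a)) q} {ℚᵘ.mkℚᵘ (ℤ.+ a) 0} (ℚᵘ.*≡* cross)
  where
  cross : ℤ.+ (suc q * a) ℤ.* ℤ.+ 1 ≡ ℤ.+ a ℤ.* ℤ.+ suc q
  cross = trans (ZP.*-identityʳ (ℤ.+ (suc q * a))) (trans (cong ℤ.+_ (NP.*-comm (suc q) a)) (ZP.pos-* a (suc q)))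

Σ[⋯]≡∑upTo : ∀ a b (g : ℕ → ℚ) → Σ[ a ⋯ b ] g ≡ ℚ∑.∑ (upTo (suc b ∸ a)) (λ k → g (a + k))
Σ[⋯]≡∑upTo a b g = cong sumℚ (sym (DLP.map-upTo (λ k → g (a + k)) (suc b ∸ a)))

alternating-sum-partial : ∀ m K →
  ℚ∑.∑ (upTo (suc K)) (λ k → sign k *ℚ ℕtoℚ (suc m C k)) ≡ sign K *ℚ ℕtoℚ (m C K)
alternating-sum-partial m zero = refl
alternating-sum-partial m (suc K) = begin
  ℚ∑.∑ (upTo (suc (suc K))) term
    ≡⟨ cong (λ l → ℚ∑.∑ l term) (sym (DLP.upTo-∷ʳ (suc K))) ⟩
  ℚ∑.∑ (upTo (suc K) ++ List.[ suc K ]) term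
    ≡⟨ ℚ∑.∑-++ (upTo (suc K)) _ term ⟩
  ℚ∑.∑ (upTo (suc K)) term +ℚ (term (suc K) +ℚ 0ℚ)
    ≡⟨ cong₂ _+ℚ_ (alternating-sum-partial m K) (QP.+-identityʳ _) ⟩
  s *ℚ ℕtoℚ (m C K) +ℚ (- s) *ℚ ℕtoℚ (suc m C suc K)
    ≡⟨ cong (λ c → s *ℚ ℕtoℚ (m C K) +ℚ (- s) *ℚ c) pascal ⟩
  s *ℚ ℕtoℚ (m C K) +ℚ (- s) *ℚ (ℕtoℚ (m C K) +ℚ ℕtoℚ (m C suc K))
    ≡⟨ telescope s (ℕtoℚ (m C K)) (ℕtoℚ (m C suc K)) ⟩
  (- s) *ℚ ℕtoℚ (m C suc K) ∎
  where
  open ≡-Reasoning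
  s = sign K
  term : ℕ → ℚ
  term k = sign k *ℚ ℕtoℚ (suc m C k)
  pascal : ℕtoℚ (suc m C suc K) ≡ ℕtoℚ (m C K) +ℚ ℕtoℚ (m C suc K)
  pascal = trans (cong ℕtoℚ (sym (Comb.nCk+nC[k+1]≡[n+1]C[k+1] m K))) (ℕtoℚ-+ (m C K) (m C suc K))
  telescope : ∀ s a b → s *ℚ a +ℚ (- s) *ℚ (a +ℚ b) ≡ (- s) *ℚ b
  telescope = QS.solve 3 (λ s a b → s QS.:* a QS.:+ (QS.:- s) QS.:* (a QS.:+ b) QS.:= (QS.:- s) QS.:* b) refl

alternating-sum : ∀ m K → m ≤ K → ℚ∑.∑ (upTo (suc K)) (λ k → sign k *ℚ ℕtoℚ (m C k)) ≡ ℕtoℚ (𝟙 (m ≟ 0))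
alternating-sum zero K _ =
  cong (1ℚ *ℚ 1ℚ +ℚ_) (trans (ℚ∑.∑-cong-∈ (applyUpTo suc K) vanish) (ℚ∑.∑-zero (applyUpTo suc K)))
  where
  vanish : ∀ {k} → k ∈ applyUpTo suc K → sign k *ℚ ℕtoℚ (0 C k) ≡ 0ℚ
  vanish k∈ with i , _ , refl ← DMP.∈-applyUpTo⁻ suc k∈ = QP.*-zeroʳ (sign (suc i))
alternating-sum (suc m) K m<K = begin
  ℚ∑.∑ (upTo (suc K)) (λ k → sign k *ℚ ℕtoℚ (suc m C k)) ≡⟨ alternating-sum-partial m K ⟩
  sign K *ℚ ℕtoℚ (m C K)                                 ≡⟨ cong (λ c → sign K *ℚ ℕtoℚ c) (Comb.k>n⇒nCk≡0 m<K) ⟩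
  sign K *ℚ 0ℚ                                           ≡⟨ QP.*-zeroʳ (sign K) ⟩
  0ℚ                                                     ∎
  where open ≡-Reasoning

binomial-inversion : ∀ {f t} i → f ≤ t →
  Σ[ i ⋯ t ] (λ j → sign (j ∸ i) *ℚ ℕtoℚ ((j C i) * (f C j))) ≡ ℕtoℚ (𝟙 (f ≟ i))
binomial-inversion {f} {t} i f≤t = begin
  Σ[ i ⋯ t ] (λ j → sign (j ∸ i) *ℚ ℕtoℚ ((j C i) * (f C j)))
    ≡⟨ Σ[⋯]≡∑upTo i t (λ j → sign (j ∸ i) *ℚ ℕtoℚ ((j C i) * (f C j))) ⟩
  ℚ∑.∑ (upTo K) (λ k → sign (i + k ∸ i) *ℚ ℕtoℚ (((i + k) C i) * (f C (i + k))))
    ≡⟨ ℚ∑.∑-cong (upTo K) reindex ⟩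
  ℚ∑.∑ (upTo K) (λ k → ℕtoℚ (f C i) *ℚ term k)
    ≡⟨ sym (ℚ∑.*-distribˡ-∑ (upTo K) (ℕtoℚ (f C i)) term) ⟩
  ℕtoℚ (f C i) *ℚ ∑term
    ≡⟨ collapse (NP.≤-<-connex i f) ⟩
  ℕtoℚ (𝟙 (f ≟ i)) ∎
  where
  open ≡-Reasoning
  K = suc t ∸ i
  term : ℕ → ℚ
  term k = sign k *ℚ ℕtoℚ ((f ∸ i) C k)
  ∑term = ℚ∑.∑ (upTo K) term
  reindex : ∀ k → sign (i + k ∸ i) *ℚ ℕtoℚ (((i + k) C i) * (f C (i + k))) ≡ ℕtoℚ (f C i) *ℚ term k
  reindex k = begin
    sign (i + k ∸ i) *ℚ ℕtoℚ (((i + k) C i) * (f C (i + k)))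
      ≡⟨ cong₂ (λ a b → sign a *ℚ ℕtoℚ b) (NP.m+n∸m≡n i k) ([i+k]Ci*fC[i+k]≡fCi*[f∸i]Ck f i k) ⟩
    sign k *ℚ ℕtoℚ ((f C i) * ((f ∸ i) C k))
      ≡⟨ cong (sign k *ℚ_) (ℕtoℚ-* (f C i) ((f ∸ i) C k)) ⟩
    sign k *ℚ (ℕtoℚ (f C i) *ℚ ℕtoℚ ((f ∸ i) C k))
      ≡⟨ ℚ*.x∙yz≈y∙xz (sign k) (ℕtoℚ (f C i)) (ℕtoℚ ((f ∸ i) C k)) ⟩
    ℕtoℚ (f C i) *ℚ term k ∎
  collapse : i ≤ f ⊎ f < i → ℕtoℚ (f C i) *ℚ ∑term ≡ ℕtoℚ (𝟙 (f ≟ i))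
  collapse (inj₂ f<i) = begin
    ℕtoℚ (f C i) *ℚ ∑term  ≡⟨ cong (λ c → ℕtoℚ c *ℚ ∑term) (Comb.k>n⇒nCk≡0 f<i) ⟩
    0ℚ *ℚ ∑term            ≡⟨ QP.*-zeroˡ ∑term ⟩
    0ℚ                     ≡⟨ cong ℕtoℚ (sym (𝟙-no (NP.<⇒≢ f<i) (f ≟ i))) ⟩
    ℕtoℚ (𝟙 (f ≟ i))       ∎
  collapse (inj₁ i≤f) = begin
    ℕtoℚ (f C i) *ℚ ∑term
      ≡⟨ cong (λ n → ℕtoℚ (f C i) *ℚ ℚ∑.∑ (upTo n) term) (NP.+-∸-assoc 1 (NP.≤-trans i≤f f≤t)) ⟩
    ℕtoℚ (f C i) *ℚ ℚ∑.∑ (upTo (suc (t ∸ i))) term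
      ≡⟨ cong (ℕtoℚ (f C i) *ℚ_) (alternating-sum (f ∸ i) (t ∸ i) (NP.∸-monoˡ-≤ i f≤t)) ⟩
    ℕtoℚ (f C i) *ℚ ℕtoℚ (𝟙 (f ∸ i ≟ 0))
      ≡⟨ sym (ℕtoℚ-* (f C i) (𝟙 (f ∸ i ≟ 0))) ⟩
    ℕtoℚ ((f C i) * 𝟙 (f ∸ i ≟ 0))
      ≡⟨ cong ℕtoℚ (fCi*𝟙[f∸i≟0]≡𝟙[f≟i] i≤f) ⟩
    ℕtoℚ (𝟙 (f ≟ i)) ∎

-- The action of C_r ≀ S_n on C_r × [n]

Point : ℕ → ℕ → Set
Point r n = Fin r × Fin n

points : (r n : ℕ) → List (Point r n)
points r n = cartesianProduct (allFin r) (allFin n)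

∈-points : ∀ {r n} (p : Point r n) → p ∈ points r n
∈-points (c , i) = DMP.∈-cartesianProduct⁺ (DMP.∈-allFin c) (DMP.∈-allFin i)

unique-points : ∀ r n → Unique (points r n)
unique-points r n = UP.cartesianProduct⁺ (UP.allFin⁺ r) (UP.allFin⁺ n)

+C-cancelˡ : ∀ {r} (c a b : Fin r) → c +C a ≡ c +C b → a ≡ b
+C-cancelˡ {suc k} c a b eq = FP.toℕ-injective (begin
  toℕ a                               ≡⟨ subtract-c a ⟩
  (toℕ (c +C a) + (r ∸ toℕ c)) % r    ≡⟨ cong (λ s → (toℕ s + (r ∸ toℕ c)) % r) eq ⟩
  (toℕ (c +C b) + (r ∸ toℕ c)) % r    ≡⟨ sym (subtract-c b) ⟩
  toℕ b                               ∎)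
  where
  open ≡-Reasoning
  r = suc k
  [m%r+e]%r≡[m+e]%r : ∀ m e → (m % r + e) % r ≡ (m + e) % r
  [m%r+e]%r≡[m+e]%r m e = begin
    (m % r + e) % r           ≡⟨ DM.%-distribˡ-+ (m % r) e r ⟩
    (m % r % r + e % r) % r   ≡⟨ cong (λ x → (x + e % r) % r) (DM.m%n%n≡m%n m r) ⟩
    (m % r + e % r) % r       ≡⟨ sym (DM.%-distribˡ-+ m e r) ⟩
    (m + e) % r               ∎
  a+[c+e]≡c+a+e : ∀ a c e → a + (c + e) ≡ c + a + e
  a+[c+e]≡c+a+e = solve-∀
  subtract-c : ∀ a → toℕ a ≡ (toℕ (c +C a) + (r ∸ toℕ c)) % r
  subtract-c a = begin
    toℕ a                                    ≡⟨ sym (DM.m<n⇒m%n≡m (FP.toℕ<n a)) ⟩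
    toℕ a % r                                ≡⟨ sym (DM.[m+n]%n≡m%n (toℕ a) r) ⟩
    (toℕ a + r) % r                          ≡⟨ cong (λ m → (toℕ a + m) % r) (sym (NP.m+[n∸m]≡n c≤r)) ⟩
    (toℕ a + (toℕ c + (r ∸ toℕ c))) % r      ≡⟨ cong (_% r) (a+[c+e]≡c+a+e (toℕ a) (toℕ c) (r ∸ toℕ c)) ⟩
    (toℕ c + toℕ a + (r ∸ toℕ c)) % r        ≡⟨ sym ([m%r+e]%r≡[m+e]%r (toℕ c + toℕ a) (r ∸ toℕ c)) ⟩
    ((toℕ c + toℕ a) % r + (r ∸ toℕ c)) % r  ≡⟨ cong (λ m → (m + (r ∸ toℕ c)) % r) (sym toℕ-c+a) ⟩
    (toℕ (c +C a) + (r ∸ toℕ c)) % r         ∎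
    where
    c≤r = NP.<⇒≤ (FP.toℕ<n c)
    toℕ-c+a = FP.toℕ-fromℕ< (DM.m%n<n (toℕ c + toℕ a) r)

module _ {r n : ℕ} where

  act-agree-recolour : ∀ (x y : W r n) {c c′ i} →
                       act x (c , i) ≡ act y (c , i) → act x (c′ , i) ≡ act y (c′ , i)
  act-agree-recolour x y {c} {c′} eq =
    cong₂ _,_ (cong (c′ +C_) (+C-cancelˡ c _ _ (cong proj₁ eq))) (cong proj₂ eq)

  module _ .{{_ : NonZero r}} where

    agreesAt : W r n → W r n → Fin n → ℕ
    agreesAt x y i = 𝟙 (act x (zeroC r , i) ≟P act y (zeroC r , i))

    fix0≡∑agreesAt : ∀ x y → fix0 x y ≡ ∑ (allFin n) (agreesAt x y)
    fix0≡∑agreesAt x y = countL≡∑𝟙 (λ i → act x (zeroC r , i) ≟P act y (zeroC r , i)) (allFin n)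

    fix0≤n : ∀ x y → fix0 x y ≤ n
    fix0≤n x y = NP.≤-trans (DLP.length-filter (λ i → act x (zeroC r , i) ≟P act y (zeroC r , i)) (allFin n))
                            (NP.≤-reflexive (length-allFin n))

    fix0-refl : ∀ x → fix0 x x ≡ n
    fix0-refl x = trans (cong length (DLP.filter-all agree? (All.universal (λ _ → refl) (allFin n))))
                        (length-allFin n)
      where agree? = λ i → act x (zeroC r , i) ≟P act x (zeroC r , i)

    θ≡fix0 : ∀ x y → θ x y ≡ fix0 x y
    θ≡fix0 x y = begin
      countL (λ p → act x p ≟P act y p) (points r n) / r
        ≡⟨ cong (_/ r) (countL≡∑𝟙 (λ p → act x p ≟P act y p) (points r n)) ⟩
      ∑ (points r n) (λ p → 𝟙 (act x p ≟P act y p)) / r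
        ≡⟨ cong (_/ r) (∑-cartesianProduct (allFin r) (allFin n) (λ p → 𝟙 (act x p ≟P act y p))) ⟩
      ∑ (allFin r) (λ c → ∑ (allFin n) (λ i → 𝟙 (act x (c , i) ≟P act y (c , i)))) / r
        ≡⟨ cong (_/ r) (∑-cong (allFin r) (λ c → ∑-cong (allFin n) (recolour c))) ⟩
      ∑ (allFin r) (λ _ → F) / r
        ≡⟨ cong (_/ r) (∑-const (allFin r) F) ⟩
      length (allFin r) * F / r
        ≡⟨ cong (λ m → m * F / r) (length-allFin r) ⟩
      r * F / r
        ≡⟨ cong (_/ r) (NP.*-comm r F) ⟩
      F * r / r
        ≡⟨ DM.m*n/n≡m F r ⟩
      F
        ≡⟨ sym (fix0≡∑agreesAt x y) ⟩
      fix0 x y ∎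
      where
      open ≡-Reasoning
      F = ∑ (allFin n) (agreesAt x y)
      recolour : ∀ c i → 𝟙 (act x (c , i) ≟P act y (c , i)) ≡ agreesAt x y i
      recolour c i = 𝟙-⇔ (act-agree-recolour x y) (act-agree-recolour x y)
                          (act x (c , i) ≟P act y (c , i)) (act x (zeroC r , i) ≟P act y (zeroC r , i))

    dist≡n∸fix0 : ∀ x y → dist x y ≡ n ∸ fix0 x y
    dist≡n∸fix0 x y = cong (n ∸_) (θ≡fix0 x y)

-- Tuples with distinct indices

module _ {r n : ℕ} where

  Fresh : ∀ {k} → Fin n → Vec (Point r n) k → Set
  Fresh i v = VAll.All (λ p → i ≢ proj₂ p) v

  fresh? : ∀ {k} (i : Fin n) (v : Vec (Point r n) k) → Dec (Fresh i v)
  fresh? i = VAll.all? (λ p → ¬? (i FP.≟ proj₂ p))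

  DistinctIndices : ∀ {k} → Vec (Point r n) k → Set
  DistinctIndices = VAllPairs.AllPairs (λ p q → proj₂ p ≢ proj₂ q)

  DistinctIndices⇒DistinctIdx : ∀ {k} {v : Vec (Point r n) k} → DistinctIndices v → DistinctIdx v
  DistinctIndices⇒DistinctIdx {v = _ ∷ _} (_ ∷ _) {fzero} {fzero} _ = refl
  DistinctIndices⇒DistinctIdx {v = _ ∷ _} (p-fresh ∷ _) {fzero} {fsuc b} eq =
    ⊥-elim (VAllP.lookup⁺ p-fresh b eq)
  DistinctIndices⇒DistinctIdx {v = _ ∷ _} (p-fresh ∷ _) {fsuc a} {fzero} eq =
    ⊥-elim (VAllP.lookup⁺ p-fresh a (sym eq))
  DistinctIndices⇒DistinctIdx {v = _ ∷ _} (_ ∷ dv) {fsuc a} {fsuc b} eq =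
    cong fsuc (DistinctIndices⇒DistinctIdx dv eq)

  module _ (x : W r n) (x-elem : IsElem x) where

    act-fresh : ∀ {k p} {u : Vec (Point r n) k} →
                Fresh (proj₂ p) u → Fresh (proj₂ (act x p)) (V.map (act x) u)
    act-fresh p-fresh = VAllP.map⁺ (VAll.map (λ p≢q eq → p≢q (x-elem eq)) p-fresh)

    act-distinct : ∀ {k} {u : Vec (Point r n) k} → DistinctIndices u → DistinctIndices (V.map (act x) u)
    act-distinct du = VAllPairsP.map⁺ (VAllPairs.map (λ p≢q eq → p≢q (x-elem eq)) du)

  count-fresh+k≡n : ∀ {k} {v : Vec (Point r n) k} → DistinctIndices v →
                    ∑ (allFin n) (λ i → 𝟙 (fresh? i v)) + k ≡ n
  count-fresh+k≡n {v = []} [] =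
    trans (NP.+-identityʳ _) (trans (∑-const (allFin n) 1) (trans (NP.*-identityʳ _) (length-allFin n)))
  count-fresh+k≡n {suc k} {p ∷ v} (p-fresh ∷ dv) = begin
    S′ + suc k                               ≡⟨ NP.+-suc S′ k ⟩
    suc S′ + k                               ≡⟨ cong (_+ k) suc[S′]≡S ⟩
    ∑ (allFin n) (λ i → 𝟙 (fresh? i v)) + k  ≡⟨ count-fresh+k≡n dv ⟩
    n                                        ∎
    where
    open ≡-Reasoning
    S′ = ∑ (allFin n) (λ i → 𝟙 (fresh? i (p ∷ v)))
    fresh-split : ∀ i → 𝟙 (fresh? i (p ∷ v)) + 𝟙 (i FP.≟ proj₂ p) * 𝟙 (fresh? i v) ≡ 𝟙 (fresh? i v)
    fresh-split i with i FP.≟ proj₂ p | fresh? i v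
    ... | yes _ | yes _ = refl
    ... | yes _ | no _ = refl
    ... | no _ | yes _ = refl
    ... | no _ | no _ = refl
    suc[S′]≡S : suc S′ ≡ ∑ (allFin n) (λ i → 𝟙 (fresh? i v))
    suc[S′]≡S = begin
      suc S′
        ≡⟨ NP.+-comm 1 S′ ⟩
      S′ + 1
        ≡⟨ cong (S′ +_) (sym (𝟙-yes p-fresh (fresh? (proj₂ p) v))) ⟩
      S′ + 𝟙 (fresh? (proj₂ p) v)
        ≡⟨ cong (S′ +_) (sym (∑-pick FP._≟_ (UP.allFin⁺ n) (DMP.∈-allFin (proj₂ p)) (λ i → 𝟙 (fresh? i v)))) ⟩
      S′ + ∑ (allFin n) (λ i → 𝟙 (i FP.≟ proj₂ p) * 𝟙 (fresh? i v))
        ≡⟨ sym (∑-+ (allFin n) _ _) ⟩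
      ∑ (allFin n) (λ i → 𝟙 (fresh? i (p ∷ v)) + 𝟙 (i FP.≟ proj₂ p) * 𝟙 (fresh? i v))
        ≡⟨ ∑-cong (allFin n) fresh-split ⟩
      ∑ (allFin n) (λ i → 𝟙 (fresh? i v)) ∎

  count-fresh≡n∸k : ∀ {k} {v : Vec (Point r n) k} → DistinctIndices v →
                    ∑ (allFin n) (λ i → 𝟙 (fresh? i v)) ≡ n ∸ k
  count-fresh≡n∸k {k} dv = trans (sym (NP.m+n∸n≡m _ k)) (cong (_∸ k) (count-fresh+k≡n dv))

  exists-fresh : ∀ {k} {v : Vec (Point r n) k} → k < n → DistinctIndices v → ∃ λ i → Fresh i v
  exists-fresh {k} {v} k<n dv = ∑𝟙-witness (λ i → fresh? i v) (allFin n)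
    (subst (0 <_) (sym (count-fresh≡n∸k dv)) (NP.m<n⇒0<n∸m k<n))

-- Designs

𝟙-∷ : ∀ {r n k} {a b : Point r n} {as bs : Vec (Point r n) k} →
      𝟙 ((a ∷ as) ≟T (b ∷ bs)) ≡ 𝟙 (a ≟P b) * 𝟙 (as ≟T bs)
𝟙-∷ {a = a} {b} {as} {bs} with a ≟P b | as ≟T bs
... | yes _ | yes _ = refl
... | yes _ | no _ = refl
... | no _ | _ = refl

∑-points-𝟙-∷ : ∀ {r n k} (a : Point r n) (as bs : Vec (Point r n) k) →
               ∑ (points r n) (λ q → 𝟙 ((a ∷ as) ≟T (q ∷ bs))) ≡ 𝟙 (as ≟T bs)
∑-points-𝟙-∷ {r} {n} a as bs = begin
  ∑ (points r n) (λ q → 𝟙 ((a ∷ as) ≟T (q ∷ bs)))    ≡⟨ ∑-cong (points r n) split ⟩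
  ∑ (points r n) (λ q → 𝟙 (q ≟P a) * 𝟙 (as ≟T bs))  ≡⟨ ∑-pick _≟P_ (unique-points r n) (∈-points a) (λ _ → 𝟙 (as ≟T bs)) ⟩
  𝟙 (as ≟T bs)                                       ∎
  where
  open ≡-Reasoning
  split : ∀ q → 𝟙 ((a ∷ as) ≟T (q ∷ bs)) ≡ 𝟙 (q ≟P a) * 𝟙 (as ≟T bs)
  split q = trans (𝟙-∷ {a = a} {q} {as} {bs}) (cong (_* 𝟙 (as ≟T bs)) (𝟙-⇔ sym sym (a ≟P q) (q ≟P a)))

IsDesignWith : ∀ {r n} (k κ : ℕ) → List (W r n) → Set
IsDesignWith {r} {n} k κ Y = (u v : Vec (Point r n) k) → DistinctIndices u → DistinctIndices v →
                             ∑ Y (λ y → 𝟙 (V.map (act y) u ≟T v)) ≡ κ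

module _ {r n : ℕ} .{{_ : NonZero r}} {Y : List (W r n)} (elems : All IsElem Y) where

  -- Extend u by a point p₀ with a fresh index and sum over the possible images q of p₀: an
  -- element of Y cannot send p₀ to a point whose index already occurs in v.
  lower-design : ∀ {k κ} → k < n → IsDesignWith (suc k) κ Y → IsDesignWith k (r * (n ∸ k) * κ) Y
  lower-design {k} {κ} k<n design u v du dv = begin
    ∑ Y (λ y → 𝟙 (V.map (act y) u ≟T v))
      ≡⟨ ∑-cong Y (λ y → sym (∑-points-𝟙-∷ (act y p₀) (V.map (act y) u) v)) ⟩
    ∑ Y (λ y → ∑ (points r n) (λ q → 𝟙 (V.map (act y) (p₀ ∷ u) ≟T (q ∷ v))))
      ≡⟨ ∑-swap Y (points r n) (λ y q → 𝟙 (V.map (act y) (p₀ ∷ u) ≟T (q ∷ v))) ⟩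
    ∑ (points r n) (λ q → ∑ Y (λ y → 𝟙 (V.map (act y) (p₀ ∷ u) ≟T (q ∷ v))))
      ≡⟨ ∑-cong (points r n) count-extended ⟩
    ∑ (points r n) (λ q → 𝟙 (fresh? (proj₂ q) v) * κ)
      ≡⟨ ∑-cartesianProduct (allFin r) (allFin n) (λ q → 𝟙 (fresh? (proj₂ q) v) * κ) ⟩
    ∑ (allFin r) (λ _ → ∑ (allFin n) (λ i → 𝟙 (fresh? i v) * κ))
      ≡⟨ ∑-const (allFin r) _ ⟩
    length (allFin r) * ∑ (allFin n) (λ i → 𝟙 (fresh? i v) * κ)
      ≡⟨ cong₂ _*_ (length-allFin r) (sym (*-distribʳ-∑ (allFin n) κ (λ i → 𝟙 (fresh? i v)))) ⟩
    r * (∑ (allFin n) (λ i → 𝟙 (fresh? i v)) * κ)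
      ≡⟨ cong (λ m → r * (m * κ)) (count-fresh≡n∸k dv) ⟩
    r * ((n ∸ k) * κ)
      ≡⟨ sym (NP.*-assoc r (n ∸ k) κ) ⟩
    r * (n ∸ k) * κ ∎
    where
    open ≡-Reasoning
    i₀ = proj₁ (exists-fresh k<n du)
    i₀-fresh = proj₂ (exists-fresh k<n du)
    p₀ : Point r n
    p₀ = (zeroC r , i₀)
    count-extended : ∀ q → ∑ Y (λ y → 𝟙 (V.map (act y) (p₀ ∷ u) ≟T (q ∷ v))) ≡ 𝟙 (fresh? (proj₂ q) v) * κ
    count-extended q with fresh? (proj₂ q) v
    ... | yes q-fresh = trans (design (p₀ ∷ u) (q ∷ v) (i₀-fresh ∷ du) (q-fresh ∷ dv)) (sym (NP.+-identityʳ κ))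
    ... | no q-used = trans (∑-cong-∈ Y vanish) (∑-zero Y)
      where
      vanish : ∀ {y} → y ∈ Y → 𝟙 (V.map (act y) (p₀ ∷ u) ≟T (q ∷ v)) ≡ 0
      vanish {y} y∈Y = 𝟙-no impossible (V.map (act y) (p₀ ∷ u) ≟T (q ∷ v))
        where
        impossible : V.map (act y) (p₀ ∷ u) ≢ q ∷ v
        impossible eq with refl , refl ← VP.∷-injective eq =
          q-used (act-fresh y (All.lookup elems y∈Y) {p = p₀} {u = u} i₀-fresh)

  lower-design-by : ∀ d {k κ} → d + k ≤ n → IsDesignWith (d + k) κ Y →
                    IsDesignWith k (r ^ d * (n ∸ k) ↓ d * κ) Y
  lower-design-by zero {k} {κ} _ design u v du dv = trans (design u v du dv) (sym (NP.+-identityʳ κ))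
  lower-design-by (suc d) {k} {κ} d+k<n design u v du dv = begin
    ∑ Y (λ y → 𝟙 (V.map (act y) u ≟T v))
      ≡⟨ lower-design-by d (NP.<⇒≤ d+k<n) (lower-design d+k<n design) u v du dv ⟩
    r ^ d * (n ∸ k) ↓ d * (r * (n ∸ (d + k)) * κ)
      ≡⟨ cong (λ m → r ^ d * (n ∸ k) ↓ d * (r * m * κ)) n∸[d+k]≡n∸k∸d ⟩
    r ^ d * (n ∸ k) ↓ d * (r * (n ∸ k ∸ d) * κ)
      ≡⟨ rearrange (r ^ d) ((n ∸ k) ↓ d) r (n ∸ k ∸ d) κ ⟩
    r * r ^ d * ((n ∸ k) ↓ d * (n ∸ k ∸ d)) * κ
      ≡⟨ cong (λ m → r * r ^ d * m * κ) (sym (↓-suc (n ∸ k) d)) ⟩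
    r ^ suc d * (n ∸ k) ↓ suc d * κ ∎
    where
    open ≡-Reasoning
    n∸[d+k]≡n∸k∸d : n ∸ (d + k) ≡ n ∸ k ∸ d
    n∸[d+k]≡n∸k∸d = trans (cong (n ∸_) (NP.+-comm d k)) (sym (NP.∸-+-assoc n k d))
    rearrange : ∀ a b c e f → a * b * (c * e * f) ≡ c * a * (b * e) * f
    rearrange = solve-∀

  design₀-length : ∀ {κ} → IsDesignWith 0 κ Y → length Y ≡ κ
  design₀-length design = trans (sym (trans (∑-const Y 1) (NP.*-identityʳ (length Y)))) (design [] [] [] [])

-- Factorial moments of the number of agreements with a fixed element

module Agreement {r n : ℕ} .{{_ : NonZero r}} {Y : List (W r n)}
                 (elems : All IsElem Y) (x : W r n) (x-elem : IsElem x) where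

  agreesOn : ∀ {k} → W r n → Vec (Point r n) k → ℕ
  agreesOn y u = 𝟙 (V.map (act y) u ≟T V.map (act x) u)

  agreesOn-∷ : ∀ {k} y i (u : Vec (Point r n) k) →
               agreesOn y ((zeroC r , i) ∷ u) ≡ agreesAt x y i * agreesOn y u
  agreesOn-∷ y i u = trans (𝟙-∷ {a = act y p} {act x p} {V.map (act y) u} {V.map (act x) u})
                           (cong (_* agreesOn y u) (𝟙-⇔ sym sym (act y p ≟P act x p) (act x p ≟P act y p)))
    where p = (zeroC r , i)

  fresh-if-disagree : ∀ {k} y (u : Vec (Point r n) k) {i} → V.map (act y) u ≡ V.map (act x) u →
                      act x (zeroC r , i) ≢ act y (zeroC r , i) → Fresh i u
  fresh-if-disagree y [] _ _ = []
  fresh-if-disagree y ((c , j) ∷ u) {i} eq disagree =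
    i≢j ∷ fresh-if-disagree y u (proj₂ (VP.∷-injective eq)) disagree
    where
    i≢j : i ≢ j
    i≢j refl = disagree (act-agree-recolour x y (sym (proj₁ (VP.∷-injective eq))))

  -- y agrees with x at every index occurring in u, so its agreements are the k indices of u
  -- together with its agreements at the fresh indices.
  fix0≡∑fresh-agreesAt+k : ∀ {k} y {u : Vec (Point r n) k} → DistinctIndices u →
                            V.map (act y) u ≡ V.map (act x) u →
                            fix0 x y ≡ ∑ (allFin n) (λ i → 𝟙 (fresh? i u) * agreesAt x y i) + k
  fix0≡∑fresh-agreesAt+k {k} y {u} du eq = NP.+-cancelʳ-≡ F (fix0 x y) (S + k) (begin
    fix0 x y + F                                   ≡⟨ cong (_+ F) (fix0≡∑agreesAt x y) ⟩
    ∑ (allFin n) (agreesAt x y) + F                ≡⟨ sym (∑-+ (allFin n) (agreesAt x y) φ) ⟩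
    ∑ (allFin n) (λ i → agreesAt x y i + φ i)      ≡⟨ ∑-cong (allFin n) pointwise ⟩
    ∑ (allFin n) (λ i → φ i * agreesAt x y i + 1)  ≡⟨ ∑-+ (allFin n) (λ i → φ i * agreesAt x y i) (λ _ → 1) ⟩
    S + ∑ (allFin n) (λ _ → 1)                     ≡⟨ cong (S +_) ∑1≡n ⟩
    S + n                                          ≡⟨ cong (S +_) (sym (count-fresh+k≡n du)) ⟩
    S + (F + k)                                    ≡⟨ cong (S +_) (NP.+-comm F k) ⟩
    S + (k + F)                                    ≡⟨ sym (NP.+-assoc S k F) ⟩
    S + k + F                                      ∎)
    where
    open ≡-Reasoning
    φ : Fin n → ℕ
    φ i = 𝟙 (fresh? i u)
    F = ∑ (allFin n) φ
    S = ∑ (allFin n) (λ i → φ i * agreesAt x y i)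
    ∑1≡n : ∑ (allFin n) (λ _ → 1) ≡ n
    ∑1≡n = trans (∑-const (allFin n) 1) (trans (NP.*-identityʳ (length (allFin n))) (length-allFin n))
    pointwise : ∀ i → agreesAt x y i + φ i ≡ φ i * agreesAt x y i + 1
    pointwise i with act x (zeroC r , i) ≟P act y (zeroC r , i) | fresh? i u
    ... | yes _ | yes _ = refl
    ... | yes _ | no _ = refl
    ... | no _ | yes _ = refl
    ... | no disagree | no used = ⊥-elim (used (fresh-if-disagree y u eq disagree))

  agreesOn*[fix0∸k] : ∀ {k} y {u : Vec (Point r n) k} → DistinctIndices u →
                      agreesOn y u * (fix0 x y ∸ k) ≡
                      agreesOn y u * ∑ (allFin n) (λ i → 𝟙 (fresh? i u) * agreesAt x y i)
  agreesOn*[fix0∸k] {k} y {u} du with V.map (act y) u ≟T V.map (act x) u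
  ... | yes eq = cong (1 *_) (trans (cong (_∸ k) (fix0≡∑fresh-agreesAt+k y du eq)) (NP.m+n∸n≡m _ k))
  ... | no _ = refl

  -- For u with distinct indices, moment u m counts the pairs (y, w) with y agreeing with x on u
  -- and w an injective m-tuple of further agreement indices; for u = [] it is the m-th
  -- factorial moment of fix0 x.
  moment : ∀ {k} → Vec (Point r n) k → ℕ → ℕ
  moment {k} u m = ∑ Y (λ y → agreesOn y u * (fix0 x y ∸ k) ↓ m)

  moment-suc : ∀ {k} {u : Vec (Point r n) k} m → DistinctIndices u →
               moment u (suc m) ≡ ∑ (allFin n) (λ i → 𝟙 (fresh? i u) * moment ((zeroC r , i) ∷ u) m)
  moment-suc {k} {u} m du = begin
    ∑ Y (λ y → agreesOn y u * (fix0 x y ∸ k) ↓ suc m)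
      ≡⟨ ∑-cong Y split ⟩
    ∑ Y (λ y → ∑ (allFin n) (λ i → φ i * term y i))
      ≡⟨ ∑-swap Y (allFin n) (λ y i → φ i * term y i) ⟩
    ∑ (allFin n) (λ i → ∑ Y (λ y → φ i * term y i))
      ≡⟨ ∑-cong (allFin n) (λ i → sym (*-distribˡ-∑ Y (φ i) (λ y → term y i))) ⟩
    ∑ (allFin n) (λ i → φ i * moment ((zeroC r , i) ∷ u) m) ∎
    where
    open ≡-Reasoning
    φ : Fin n → ℕ
    φ i = 𝟙 (fresh? i u)
    term : W r n → Fin n → ℕ
    term y i = agreesOn y ((zeroC r , i) ∷ u) * (fix0 x y ∸ suc k) ↓ m
    split : ∀ y → agreesOn y u * (fix0 x y ∸ k) ↓ suc m ≡ ∑ (allFin n) (λ i → φ i * term y i)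
    split y = begin
      a * ((f ∸ k) * pred (f ∸ k) ↓ m)
        ≡⟨ cong (λ l → a * ((f ∸ k) * l ↓ m)) (NP.pred[m∸n]≡m∸[1+n] f k) ⟩
      a * ((f ∸ k) * g)
        ≡⟨ sym (NP.*-assoc a (f ∸ k) g) ⟩
      a * (f ∸ k) * g
        ≡⟨ cong (_* g) (agreesOn*[fix0∸k] y du) ⟩
      a * ∑ (allFin n) (λ i → φ i * agreesAt x y i) * g
        ≡⟨ cong (_* g) (*-distribˡ-∑ (allFin n) a (λ i → φ i * agreesAt x y i)) ⟩
      ∑ (allFin n) (λ i → a * (φ i * agreesAt x y i)) * g
        ≡⟨ *-distribʳ-∑ (allFin n) g (λ i → a * (φ i * agreesAt x y i)) ⟩
      ∑ (allFin n) (λ i → a * (φ i * agreesAt x y i) * g)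
        ≡⟨ ∑-cong (allFin n) (λ i → rearrange a (φ i) (agreesAt x y i) g) ⟩
      ∑ (allFin n) (λ i → φ i * (agreesAt x y i * a * g))
        ≡⟨ ∑-cong (allFin n) (λ i → cong (λ b → φ i * (b * g)) (sym (agreesOn-∷ y i u))) ⟩
      ∑ (allFin n) (λ i → φ i * term y i) ∎
      where
      a = agreesOn y u
      f = fix0 x y
      g = (f ∸ suc k) ↓ m
      rearrange : ∀ a b c d → a * (b * c) * d ≡ b * (c * a * d)
      rearrange = solve-∀

  moment-design : ∀ m {k κ} {u : Vec (Point r n) k} → DistinctIndices u → IsDesignWith (m + k) κ Y →
                  moment u m ≡ (n ∸ k) ↓ m * κ
  moment-design zero {k} {κ} {u} du design = begin
    ∑ Y (λ y → agreesOn y u * 1)   ≡⟨ ∑-cong Y (λ y → NP.*-identityʳ (agreesOn y u)) ⟩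
    ∑ Y (λ y → agreesOn y u)       ≡⟨ design u (V.map (act x) u) du (act-distinct x x-elem du) ⟩
    κ                              ≡⟨ sym (NP.+-identityʳ κ) ⟩
    1 * κ                          ∎
    where open ≡-Reasoning
  moment-design (suc m) {k} {κ} {u} du design = begin
    moment u (suc m)
      ≡⟨ moment-suc m du ⟩
    ∑ (allFin n) (λ i → 𝟙 (fresh? i u) * moment ((zeroC r , i) ∷ u) m)
      ≡⟨ ∑-cong (allFin n) extend ⟩
    ∑ (allFin n) (λ i → 𝟙 (fresh? i u) * c)
      ≡⟨ sym (*-distribʳ-∑ (allFin n) c (λ i → 𝟙 (fresh? i u))) ⟩
    ∑ (allFin n) (λ i → 𝟙 (fresh? i u)) * c
      ≡⟨ cong (_* c) (count-fresh≡n∸k du) ⟩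
    (n ∸ k) * ((n ∸ suc k) ↓ m * κ)
      ≡⟨ sym (NP.*-assoc (n ∸ k) ((n ∸ suc k) ↓ m) κ) ⟩
    (n ∸ k) * (n ∸ suc k) ↓ m * κ
      ≡⟨ cong (λ l → (n ∸ k) * l ↓ m * κ) (sym (NP.pred[m∸n]≡m∸[1+n] n k)) ⟩
    (n ∸ k) ↓ suc m * κ ∎
    where
    open ≡-Reasoning
    c = (n ∸ suc k) ↓ m * κ
    design′ : IsDesignWith (m + suc k) κ Y
    design′ = subst (λ l → IsDesignWith l κ Y) (sym (NP.+-suc m k)) design
    extend : ∀ i → 𝟙 (fresh? i u) * moment ((zeroC r , i) ∷ u) m ≡ 𝟙 (fresh? i u) * c
    extend i with fresh? i u
    ... | yes i-fresh = cong (1 *_) (moment-design m (i-fresh ∷ du) design′)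
    ... | no _ = refl

  factorial-moment : ∀ {j κ} → IsDesignWith j κ Y → ∑ Y (λ y → fix0 x y ↓ j) ≡ n ↓ j * κ
  factorial-moment {j} {κ} design = begin
    ∑ Y (λ y → fix0 x y ↓ j)   ≡⟨ ∑-cong Y (λ y → sym (NP.*-identityˡ (fix0 x y ↓ j))) ⟩
    moment [] j                ≡⟨ moment-design j [] design′ ⟩
    n ↓ j * κ                  ∎
    where
    open ≡-Reasoning
    design′ = subst (λ l → IsDesignWith l κ Y) (sym (NP.+-identityʳ j)) design

  binomial-moment : ∀ {j κ} → IsDesignWith j κ Y → ∑ Y (λ y → fix0 x y C j) ≡ (n C j) * κ
  binomial-moment {j} {κ} design = NP.*-cancelʳ-≡ _ _ (j !) {{j NP.!≢0}} (begin
    ∑ Y (λ y → fix0 x y C j) * j !     ≡⟨ *-distribʳ-∑ Y (j !) (λ y → fix0 x y C j) ⟩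
    ∑ Y (λ y → (fix0 x y C j) * j !)   ≡⟨ ∑-cong Y (λ y → sym (a↓k≡aCk*k! (fix0 x y) j)) ⟩
    ∑ Y (λ y → fix0 x y ↓ j)           ≡⟨ factorial-moment design ⟩
    n ↓ j * κ                          ≡⟨ cong (_* κ) (a↓k≡aCk*k! n j) ⟩
    (n C j) * j ! * κ                  ≡⟨ xy∙z≈xz∙y (n C j) (j !) κ ⟩
    (n C j) * κ * j !                  ∎)
    where open ≡-Reasoning

-- The distance distribution

module DistanceDistribution {r n t c : ℕ} .{{_ : NonZero r}} (t<n : t < n) {Y : List (W r n)}
  (elems : All IsElem Y) (unique : Unique Y) (design : IsDesignWith t c Y)
  (code : ∀ {x y} → x ∈ Y → y ∈ Y → x ≢ y → fix0 x y ≤ t) where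

  -- the constant of Y as a j-design
  κ : ℕ → ℕ
  κ j = r ^ (t ∸ j) * (n ∸ j) ↓ (t ∸ j) * c

  design-below : ∀ {j} → j ≤ t → IsDesignWith j (κ j) Y
  design-below {j} j≤t = lower-design-by elems (t ∸ j) (NP.≤-trans (NP.≤-reflexive t∸j+j≡t) (NP.<⇒≤ t<n))
                                          (subst (λ l → IsDesignWith l c Y) (sym t∸j+j≡t) design)
    where t∸j+j≡t = NP.m∸n+n≡m j≤t

  |Y|≡r^j*n↓j*κ : ∀ {j} → j ≤ t → length Y ≡ r ^ j * n ↓ j * κ j
  |Y|≡r^j*n↓j*κ {j} j≤t = begin
    length Y                                     ≡⟨ design₀-length elems (design-below z≤n) ⟩
    r ^ t * n ↓ t * c                            ≡⟨ cong (λ l → r ^ l * n ↓ l * c) (sym (NP.m+[n∸m]≡n j≤t)) ⟩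
    r ^ (j + d) * n ↓ (j + d) * c                ≡⟨ cong₂ (λ a b → a * b * c) (NP.^-distribˡ-+-* r j d) (↓-+ n j d) ⟩
    r ^ j * r ^ d * (n ↓ j * (n ∸ j) ↓ d) * c    ≡⟨ rearrange (r ^ j) (r ^ d) (n ↓ j) ((n ∸ j) ↓ d) c ⟩
    r ^ j * n ↓ j * κ j                          ∎
    where
    open ≡-Reasoning
    d = t ∸ j
    rearrange : ∀ a b e f g → a * b * (e * f) * g ≡ a * e * (b * f * g)
    rearrange = solve-∀

  ℕtoℚ-κ : ∀ {j} → j ≤ t → ℕtoℚ (κ j) ≡ length Y ÷ℕ (r ^ j * (n P j))
  ℕtoℚ-κ {j} j≤t = sym (begin
    length Y ÷ℕ (r ^ j * (n P j))             ≡⟨ cong₂ _÷ℕ_ (|Y|≡r^j*n↓j*κ j≤t) (cong (r ^ j *_) (nPk≡n↓k j≤n)) ⟩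
    (r ^ j * n ↓ j * κ j) ÷ℕ (r ^ j * n ↓ j)  ≡⟨ [q*a]÷ℕq≡a (r ^ j * n ↓ j) (κ j) {{r^j*n↓j≢0}} ⟩
    ℕtoℚ (κ j)                                ∎)
    where
    open ≡-Reasoning
    j≤n = NP.≤-trans j≤t (NP.<⇒≤ t<n)
    r^j*n↓j≢0 = NP.m*n≢0 (r ^ j) (n ↓ j) {{NP.m^n≢0 r j}} {{↓-nonZero j≤n}}

  module _ {x} (x∈Y : x ∈ Y) where
    open Agreement elems x (All.lookup elems x∈Y)

    others : List (W r n)
    others = List.filter (λ y → ¬? (y ≟W x)) Y

    fix0-others≤t : ∀ {y} → y ∈ others → fix0 x y ≤ t
    fix0-others≤t y∈others with y∈Y , y≢x ← DMP.∈-filter⁻ (λ y → ¬? (y ≟W x)) y∈others =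
      code x∈Y y∈Y (y≢x ∘ sym)

    binomial-moment-others : ∀ {j} → j ≤ t →
      ℚ∑.∑ others (λ y → ℕtoℚ (fix0 x y C j)) ≡ ℕtoℚ (n C j) *ℚ ((length Y ÷ℕ (r ^ j * (n P j))) -ℚ 1ℚ)
    binomial-moment-others {j} j≤t = begin
      ℚ∑.∑ others (λ y → ℕtoℚ (fix0 x y C j))
        ≡⟨ sym (ℕtoℚ-∑ others (λ y → fix0 x y C j)) ⟩
      ℕtoℚ s
        ≡⟨ s≡[b+s]-b (ℕtoℚ b) (ℕtoℚ s) ⟩
      (ℕtoℚ b +ℚ ℕtoℚ s) -ℚ ℕtoℚ b
        ≡⟨ cong (_-ℚ ℕtoℚ b) (trans (sym (ℕtoℚ-+ b s)) (trans (cong ℕtoℚ b+s≡b*κ) (ℕtoℚ-* b (κ j)))) ⟩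
      ℕtoℚ b *ℚ ℕtoℚ (κ j) -ℚ ℕtoℚ b
        ≡⟨ b*k-b≡b*[k-1] (ℕtoℚ b) (ℕtoℚ (κ j)) ⟩
      ℕtoℚ b *ℚ (ℕtoℚ (κ j) -ℚ 1ℚ)
        ≡⟨ cong (λ q → ℕtoℚ b *ℚ (q -ℚ 1ℚ)) (ℕtoℚ-κ j≤t) ⟩
      ℕtoℚ b *ℚ ((length Y ÷ℕ (r ^ j * (n P j))) -ℚ 1ℚ) ∎
      where
      open ≡-Reasoning
      b = n C j
      s = ∑ others (λ y → fix0 x y C j)
      b+s≡b*κ : b + s ≡ b * κ j
      b+s≡b*κ = begin
        b + s                     ≡⟨ cong (λ f → (f C j) + s) (sym (fix0-refl x)) ⟩
        (fix0 x x C j) + s        ≡⟨ sym (∑-remove _≟W_ unique x∈Y (λ y → fix0 x y C j)) ⟩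
        ∑ Y (λ y → fix0 x y C j)  ≡⟨ binomial-moment (design-below j≤t) ⟩
        b * κ j                   ∎
      s≡[b+s]-b : ∀ b s → s ≡ (b +ℚ s) -ℚ b
      s≡[b+s]-b = QS.solve 2 (λ b s → s QS.:= (b QS.:+ s) QS.:- b) refl
      b*k-b≡b*[k-1] : ∀ b k → b *ℚ k -ℚ b ≡ b *ℚ (k -ℚ 1ℚ)
      b*k-b≡b*[k-1] = QS.solve 2 (λ b k → b QS.:* k QS.:- b QS.:= b QS.:* (k QS.:- QS.con 1ℚ)) refl

    distance-count-others : ∀ {i} → i < n →
                            ∑ Y (λ y → 𝟙 (dist x y ≟ n ∸ i)) ≡ ∑ others (λ y → 𝟙 (fix0 x y ≟ i))
    distance-count-others {i} i<n = begin
      ∑ Y (λ y → 𝟙 (dist x y ≟ n ∸ i))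
        ≡⟨ ∑-cong Y (λ y → 𝟙-⇔ (to y) (from y) (dist x y ≟ n ∸ i) (fix0 x y ≟ i)) ⟩
      ∑ Y (λ y → 𝟙 (fix0 x y ≟ i))
        ≡⟨ ∑-remove _≟W_ unique x∈Y (λ y → 𝟙 (fix0 x y ≟ i)) ⟩
      𝟙 (fix0 x x ≟ i) + S
        ≡⟨ cong (_+ S) (𝟙-no (λ e → NP.<⇒≢ i<n (trans (sym e) (fix0-refl x))) (fix0 x x ≟ i)) ⟩
      S ∎
      where
      open ≡-Reasoning
      S : ℕ
      S = ∑ others (λ y → 𝟙 (fix0 x y ≟ i))
      to : ∀ y → dist x y ≡ n ∸ i → fix0 x y ≡ i
      to y e = NP.∸-cancelˡ-≡ (fix0≤n x y) (NP.<⇒≤ i<n) (trans (sym (dist≡n∸fix0 x y)) e)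
      from : ∀ y → fix0 x y ≡ i → dist x y ≡ n ∸ i
      from y e = trans (dist≡n∸fix0 x y) (cong (n ∸_) e)

    distance-count : ∀ {i} → i < n → ℕtoℚ (∑ Y (λ y → 𝟙 (dist x y ≟ n ∸ i))) ≡ rhs r n t (length Y) i
    distance-count {i} i<n = begin
      ℕtoℚ (∑ Y (λ y → 𝟙 (dist x y ≟ n ∸ i)))
        ≡⟨ cong ℕtoℚ (distance-count-others i<n) ⟩
      ℕtoℚ (∑ others (λ y → 𝟙 (fix0 x y ≟ i)))
        ≡⟨ ℕtoℚ-∑ others (λ y → 𝟙 (fix0 x y ≟ i)) ⟩
      ℚ∑.∑ others (λ y → ℕtoℚ (𝟙 (fix0 x y ≟ i)))
        ≡⟨ ℚ∑.∑-cong-∈ others inversion ⟩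
      ℚ∑.∑ others (λ y → ℚ∑.∑ (upTo K) (λ k → T y (i + k)))
        ≡⟨ ℚ∑.∑-swap others (upTo K) (λ y k → T y (i + k)) ⟩
      ℚ∑.∑ (upTo K) (λ k → ℚ∑.∑ others (λ y → T y (i + k)))
        ≡⟨ ℚ∑.∑-cong-∈ (upTo K) (λ {k} k∈ → term-moment {i + k} (i+k≤t (DMP.∈-upTo⁻ k∈))) ⟩
      ℚ∑.∑ (upTo K) (λ k → R (i + k))
        ≡⟨ sym (Σ[⋯]≡∑upTo i t R) ⟩
      rhs r n t (length Y) i ∎
      where
      open ≡-Reasoning
      K = suc t ∸ i
      T : W r n → ℕ → ℚ
      T y j = sign (j ∸ i) *ℚ ℕtoℚ ((j C i) * (fix0 x y C j))
      R : ℕ → ℚ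
      R j = sign (j ∸ i) *ℚ ℕtoℚ ((j C i) * (n C j)) *ℚ ((length Y ÷ℕ (r ^ j * (n P j))) -ℚ 1ℚ)
      inversion : ∀ {y} → y ∈ others → ℕtoℚ (𝟙 (fix0 x y ≟ i)) ≡ ℚ∑.∑ (upTo K) (λ k → T y (i + k))
      inversion {y} y∈others =
        trans (sym (binomial-inversion {fix0 x y} {t} i (fix0-others≤t y∈others))) (Σ[⋯]≡∑upTo i t (T y))
      term-moment : ∀ {j} → j ≤ t → ℚ∑.∑ others (λ y → T y j) ≡ R j
      term-moment {j} j≤t = begin
        ℚ∑.∑ others (λ y → s *ℚ ℕtoℚ ((j C i) * (fix0 x y C j)))
          ≡⟨ ℚ∑.∑-cong others (λ y → trans (cong (s *ℚ_) (ℕtoℚ-* (j C i) (fix0 x y C j))) (sym (assoc y))) ⟩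
        ℚ∑.∑ others (λ y → s *ℚ ℕtoℚ (j C i) *ℚ ℕtoℚ (fix0 x y C j))
          ≡⟨ sym (ℚ∑.*-distribˡ-∑ others (s *ℚ ℕtoℚ (j C i)) (λ y → ℕtoℚ (fix0 x y C j))) ⟩
        s *ℚ ℕtoℚ (j C i) *ℚ ℚ∑.∑ others (λ y → ℕtoℚ (fix0 x y C j))
          ≡⟨ cong (s *ℚ ℕtoℚ (j C i) *ℚ_) (binomial-moment-others j≤t) ⟩
        s *ℚ ℕtoℚ (j C i) *ℚ (ℕtoℚ (n C j) *ℚ L)
          ≡⟨ sym (QP.*-assoc (s *ℚ ℕtoℚ (j C i)) (ℕtoℚ (n C j)) L) ⟩
        s *ℚ ℕtoℚ (j C i) *ℚ ℕtoℚ (n C j) *ℚ L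
          ≡⟨ cong (_*ℚ L) (trans (QP.*-assoc s (ℕtoℚ (j C i)) (ℕtoℚ (n C j))) (cong (s *ℚ_) (sym (ℕtoℚ-* (j C i) (n C j))))) ⟩
        R j ∎
        where
        s = sign (j ∸ i)
        L = (length Y ÷ℕ (r ^ j * (n P j))) -ℚ 1ℚ
        assoc : ∀ y → s *ℚ ℕtoℚ (j C i) *ℚ ℕtoℚ (fix0 x y C j) ≡ s *ℚ (ℕtoℚ (j C i) *ℚ ℕtoℚ (fix0 x y C j))
        assoc y = QP.*-assoc s (ℕtoℚ (j C i)) (ℕtoℚ (fix0 x y C j))

  length-nonZero : 0 < c → NonZero (length Y)
  length-nonZero c>0 = subst NonZero (sym (design₀-length elems (design-below z≤n)))
    (NP.m*n≢0 (r ^ t * n ↓ t) c {{r^t*n↓t≢0}} {{>-nonZero c>0}})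
    where
    r^t*n↓t≢0 : NonZero (r ^ t * n ↓ t)
    r^t*n↓t≢0 = NP.m*n≢0 (r ^ t) (n ↓ t) {{NP.m^n≢0 r t}} {{↓-nonZero (NP.<⇒≤ t<n)}}

  A[n∸i]≡rhs : 0 < c → ∀ {i} → i < n → A Y (n ∸ i) ≡ rhs r n t (length Y) i
  A[n∸i]≡rhs c>0 {i} i<n = begin
    countL distance≟ (cartesianProduct Y Y) ÷ℕ length Y
      ≡⟨ cong (_÷ℕ length Y) (trans (countL≡∑𝟙 distance≟ (cartesianProduct Y Y)) (∑-cartesianProduct Y Y (𝟙 ∘ distance≟))) ⟩
    ∑ Y (λ x → count x) ÷ℕ length Y
      ≡⟨ cong (_÷ℕ length Y) (trans (∑-cong-∈ Y count-constant) (∑-const Y (count x₀))) ⟩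
    (length Y * count x₀) ÷ℕ length Y
      ≡⟨ [q*a]÷ℕq≡a (length Y) (count x₀) {{length-nonZero c>0}} ⟩
    ℕtoℚ (count x₀)
      ≡⟨ distance-count x₀∈Y i<n ⟩
    rhs r n t (length Y) i ∎
    where
    open ≡-Reasoning
    x₀ : W r n
    x₀ = proj₁ (nonZero-length⇒∈ {xs = Y} (length-nonZero c>0))
    x₀∈Y : x₀ ∈ Y
    x₀∈Y = proj₂ (nonZero-length⇒∈ {xs = Y} (length-nonZero c>0))
    distance≟ : (xy : W r n × W r n) → Dec (dist (proj₁ xy) (proj₂ xy) ≡ n ∸ i)
    distance≟ (x , y) = dist x y ≟ n ∸ i
    count : W r n → ℕ
    count x = ∑ Y (λ y → 𝟙 (dist x y ≟ n ∸ i))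
    count-constant : ∀ {x} → x ∈ Y → count x ≡ count x₀
    count-constant {x} x∈Y = ℕtoℚ-injective {count x} {count x₀} (trans (distance-count x∈Y i<n) (sym (distance-count x₀∈Y i<n)))

theorem6p6 : (r n t : ℕ) → .{{_ : NonZero r}} → .{{_ : NonZero n}} → t < n →
    (Y : List (W r n)) → All IsElem Y → Unique Y →
    IsDesign t Y → IsCode (n ∸ t) Y →
    (i : ℕ) → i < n → A Y (n ∸ i) ≡ rhs r n t (length Y) i
theorem6p6 r n t t<n Y elems unique (c , c>0 , design) code i i<n =
  DistanceDistribution.A[n∸i]≡rhs t<n elems unique designWith code′ c>0 i<n
  where
  designWith : IsDesignWith t c Y
  designWith u v du dv = trans (sym (countL≡∑𝟙 (λ y → V.map (act y) u ≟T v) Y))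
                               (design u v (DistinctIndices⇒DistinctIdx du) (DistinctIndices⇒DistinctIdx dv))
  code′ : ∀ {x y} → x ∈ Y → y ∈ Y → x ≢ y → fix0 x y ≤ t
  code′ {x} {y} x∈Y y∈Y x≢y = subst (fix0 x y ≤_) (NP.m∸[m∸n]≡n (NP.<⇒≤ t<n)) (code x∈Y y∈Y x≢y)
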